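{- Let $M$ be a $\lambda$-term. If there exist $a\in T_r(M)$ and $n\in\mathbb N$ such that $L_r^n(a)$ is a positive rigid term in $\to_r$-normal form, then $L^n(M)$ is a $\beta$-normal form.
   Context: Rigid resource terms: $a ::= x\mid \lambda x.a\mid \langle c\rangle\vec d\mid 0$, $\vec d=(d_1,\dots,d_n)$ a finite list of rigid terms; up to $\alpha$; $0$ absorbing ($\lambda x.0=0$, $\langle0\rangle\vec d=0$, a list containing $0$ equals $0$). Rigid substitution $a[\vec b/x]$, $\vec b=(b_1,\dots,b_k)$: if $x$ has exactly $k$ free occurrences in $a$, replace the $i$-th (left-to-right) by $b_i$; else $0$. Rigid reduction $\to_r$: contextual closure of $\langle\lambda x.a\rangle\vec b\to_r a[\vec b/x]$. Rigid expansion: $T_r(x)=\{x\}$, $T_r(\lambda x.M)=\{\lambda x.a\mid a\in T_r(M)\}$, $T_r(PQ)=\{\langle c\rangle(d_1,\dots,d_n)\mid c\in T_r(P), n\ge0, d_i\in T_r(Q)\}$. Positive rigid terms: $x$; $\lambda x.a$ with $a$ positive; $\langle c\rangle(d_1,\dots,d_n)$ with $n\ge1$ and $c,d_i$ positive. Left-parallel reduction: $L(M)=M$ if $M$ is $\beta$-normal; $L(\lambda\vec x.yQ_1\dots Q_n)=\lambda\vec x.yL(Q_1)\dots L(Q_n)$ for $y$ a variable and $M$ not $\beta$-normal; $L(\lambda\vec x.(\lambda x.P)QQ_1\dots Q_n)=\lambda\vec x.P[Q/x]Q_1\dots Q_n$. Rigid version: $L_r(a)=a$ if $a$ is $\to_r$-normal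 (including $0$); $L_r(\lambda\vec x.\langle\cdots\langle y\rangle\vec d_1\cdots\rangle\vec d_n)=\lambda\vec x.\langle\cdots\langle y\rangle L_r(\vec d_1)\cdots\rangle L_r(\vec d_n)$ otherwise ($y$ a variable, $L_r$ componentwise on lists); $L_r(\lambda\vec x.\langle\cdots\langle\langle\lambda x.c\rangle\vec d\rangle\vec d_1\cdots\rangle\vec d_n)=\lambda\vec x.\langle\cdots\langle c[\vec d/x]\rangle\vec d_1\cdots\rangle\vec d_n$. -}

module Defs where

open import Data.Nat using (ℕ; zero; suc; _+_; _∸_; _<ᵇ_; _≡ᵇ_)
open import Data.Bool using (Bool; true; false; _∧_; if_then_else_; T)
open import Data.List using (List; []; _∷_)
open import Data.List.Relation.Unary.All using (All)
open import Data.Maybe using (Maybe; just; nothing)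
open import Data.Product using (_×_; _,_)

iter : {A : Set} → ℕ → (A → A) → A → A
iter zero    f x = x
iter (suc n) f x = f (iter n f x)

-- λ-terms (de Bruijn indices, so terms are taken up to α)

data Term : Set where
  var : ℕ → Term
  lam : Term → Term
  app : Term → Term → Term

shift : ℕ → ℕ → Term → Term
shift k c (var v)   = if v <ᵇ c then var v else var (v + k)
shift k c (lam M)   = lam (shift k (suc c) M)
shift k c (app P Q) = app (shift k c P) (shift k c Q)

-- substitute Q (living outside the binder) for index d, lowering others
substAt : ℕ → Term → Term → Term
substAt d (var v) Q =
  if v <ᵇ d then var v else (if v ≡ᵇ d then shift d 0 Q else var (v ∸ 1))
substAt d (lam M)   Q = lam (substAt (suc d) M Q)
substAt d (app P R) Q = app (substAt d P Q) (substAt d R Q)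

-- P[Q/x] where P is the body of λx.P (x = index 0)
_[_/0] : Term → Term → Term
P [ Q /0] = substAt 0 P Q

isNF : Term → Bool
isNF (var v)           = true
isNF (lam M)           = isNF M
isNF (app (lam P) Q)   = false
isNF (app P Q)         = isNF P ∧ isNF Q

BetaNormal : Term → Set
BetaNormal M = T (isNF M)

headIsVar : Term → Bool
headIsVar (var v)   = true
headIsVar (lam M)   = false
headIsVar (app P Q) = headIsVar P

mutual
  L : Term → Term
  L M = if isNF M then M else L′ M

  L′ : Term → Term
  L′ (lam M) = lam (L′ M)
  L′ M       = Lsp M

  Lsp : Term → Term
  Lsp (var v)         = var v
  Lsp (lam M)         = lam M
  Lsp (app (lam P) Q) = P [ Q /0]
  Lsp (app P Q)       = if headIsVar P then app (Lsp P) (L Q) else app (Lsp P) Q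

-- Rigid resource terms (de Bruijn). A rigid term is either 0 or a
-- non-zero term; since 0 is absorbing, the rigid terms are exactly
-- Maybe RT with nothing = 0.

data RT : Set where
  rvar : ℕ → RT
  rlam : RT → RT
  rapp : RT → List RT → RT

RTerm : Set
RTerm = Maybe RT

mutual
  rshift : ℕ → ℕ → RT → RT
  rshift k c (rvar v)    = if v <ᵇ c then rvar v else rvar (v + k)
  rshift k c (rlam a)    = rlam (rshift k (suc c) a)
  rshift k c (rapp a ds) = rapp (rshift k c a) (rshifts k c ds)

  rshifts : ℕ → ℕ → List RT → List RT
  rshifts k c []       = []
  rshifts k c (d ∷ ds) = rshift k c d ∷ rshifts k c ds

-- Replace, left to right, the occurrences of index d by the successive
-- elements of the list; returns the unused rest of the list, or nothing
-- if the list runs out.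
mutual
  rsub : ℕ → RT → List RT → Maybe (RT × List RT)
  rsub d (rvar v) bs with v <ᵇ d | v ≡ᵇ d
  ... | true  | _    = just (rvar v , bs)
  ... | false | false = just (rvar (v ∸ 1) , bs)
  ... | false | true with bs
  ...   | []      = nothing
  ...   | b ∷ bs′ = just (rshift d 0 b , bs′)
  rsub d (rlam a) bs with rsub (suc d) a bs
  ... | nothing         = nothing
  ... | just (a′ , bs′) = just (rlam a′ , bs′)
  rsub d (rapp c es) bs with rsub d c bs
  ... | nothing          = nothing
  ... | just (c′ , bs₁) with rsubs d es bs₁
  ...   | nothing          = nothing
  ...   | just (es′ , bs₂) = just (rapp c′ es′ , bs₂)

  rsubs : ℕ → List RT → List RT → Maybe (List RT × List RT)
  rsubs d [] bs = just ([] , bs)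
  rsubs d (e ∷ es) bs with rsub d e bs
  ... | nothing         = nothing
  ... | just (e′ , bs₁) with rsubs d es bs₁
  ...   | nothing          = nothing
  ...   | just (es′ , bs₂) = just (e′ ∷ es′ , bs₂)

-- Rigid substitution a[b⃗/x] for a the body of λx.a (x = index 0):
-- nonzero iff x has exactly length b⃗ free occurrences in a.
rsubst : RT → List RT → RTerm
rsubst a bs with rsub 0 a bs
... | just (r , []) = just r
... | _             = nothing

mutual
  isRNF : RT → Bool
  isRNF (rvar v)           = true
  isRNF (rlam a)           = isRNF a
  isRNF (rapp (rlam c) ds) = false
  isRNF (rapp c ds)        = isRNF c ∧ allRNF ds

  allRNF : List RT → Bool
  allRNF []       = true
  allRNF (d ∷ ds) = isRNF d ∧ allRNF ds

RNormal : RTerm → Set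
RNormal nothing  = T true
RNormal (just a) = T (isRNF a)

data Positive : RT → Set where
  pvar : ∀ {x} → Positive (rvar x)
  plam : ∀ {a} → Positive a → Positive (rlam a)
  papp : ∀ {c d ds} → Positive c → All Positive (d ∷ ds) → Positive (rapp c (d ∷ ds))

PositiveR : RTerm → Set
PositiveR nothing  = T false
PositiveR (just a) = Positive a

data _∈T_ : RT → Term → Set where
  tvar : ∀ {x} → rvar x ∈T var x
  tlam : ∀ {a M} → a ∈T M → rlam a ∈T lam M
  tapp : ∀ {c P ds Q} → c ∈T P → All (_∈T Q) ds → rapp c ds ∈T app P Q

rheadIsVar : RT → Bool
rheadIsVar (rvar v)    = true
rheadIsVar (rlam a)    = false
rheadIsVar (rapp c ds) = rheadIsVar c

mutual
  Lr : RTerm → RTerm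
  Lr nothing  = nothing
  Lr (just a) = if isRNF a then just a else Lr′ a

  Lr′ : RT → RTerm
  Lr′ (rlam a) with Lr′ a
  ... | nothing = nothing
  ... | just a′ = just (rlam a′)
  Lr′ a = Lrsp a

  Lrsp : RT → RTerm
  Lrsp (rvar v)           = just (rvar v)
  Lrsp (rlam a)           = just (rlam a)
  Lrsp (rapp (rlam c) ds) = rsubst c ds
  Lrsp (rapp c ds) with Lrsp c
  ... | nothing = nothing
  ... | just c′ with rheadIsVar c
  ...   | false = just (rapp c′ ds)
  ...   | true with Lrs ds
  ...     | nothing  = nothing
  ...     | just ds′ = just (rapp c′ ds′)

  Lrs : List RT → Maybe (List RT)
  Lrs [] = just []
  Lrs (d ∷ ds) with Lr (just d) | Lrs ds
  ... | just d′ | just ds′ = just (d′ ∷ ds′)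
  ... | _       | _        = nothing

module Submission where

-- The proof is a simulation argument.  Write r ∈T₀ M for "r is 0 or r ∈ T_r(M)".
--   * Expansion commutes with shifting and, rigidly, with substitution:
--     if c ∈ T_r(P) and every bᵢ ∈ T_r(Q) then c[b⃗/x] ∈T₀ P[Q/x].
--   * An expansion of a β-normal term is →r-normal; conversely a positive
--     →r-normal expansion of M forces M to be β-normal (positivity rules out
--     empty argument lists, which would hide redexes of M).
--   * L fixes →r-normal expansions: if a ∈ T_r(M) is →r-normal then a ∈ T_r(L M).
--   * Hence one step of L_r is simulated by one step of L:
--     a ∈T₀ M implies L_r(a) ∈T₀ L(M), and by induction L_rⁿ(a) ∈T₀ Lⁿ(M).
-- The theorem follows by applying the second bullet to L_rⁿ(a) ∈ T_r(Lⁿ(M)).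

open import Defs
open import Data.Nat using (ℕ; zero; suc; _<ᵇ_; _≡ᵇ_)
open import Data.Bool using (true; false; _∧_; T; if_then_else_)
open import Data.Bool.Properties using (T-∧; T-≡)
open import Data.Product using (∃; _×_; _,_; proj₁; proj₂)
open import Data.Maybe using (Maybe; just; nothing)
open import Data.List using (List; []; _∷_)
open import Data.List.Relation.Unary.All using (All; []; _∷_)
open import Data.Unit using (⊤; tt)
open import Data.Empty using (⊥-elim)
open import Function.Bundles using (Equivalence)
open import Relation.Binary.PropositionalEquality using (_≡_; refl; subst)

∧-intro : ∀ {x y} → T x → T y → T (x ∧ y)
∧-intro tx ty = Equivalence.from T-∧ (tx , ty)

∧-elimˡ : ∀ {x y} → T (x ∧ y) → T x
∧-elimˡ t = proj₁ (Equivalence.to T-∧ t)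

∧-elimʳ : ∀ {x y} → T (x ∧ y) → T y
∧-elimʳ t = proj₂ (Equivalence.to T-∧ t)

if-elim : ∀ {A : Set} (P : A → Set) b {x y : A} → P x → P y → P (if b then x else y)
if-elim P true  px _  = px
if-elim P false _  py = py

_∈T₀_ : RTerm → Term → Set
nothing ∈T₀ M = ⊤
just a  ∈T₀ M = a ∈T M

_∈Tˢ_ : Maybe (List RT) → Term → Set
nothing ∈Tˢ Q = ⊤
just ds ∈Tˢ Q = All (_∈T Q) ds

mutual
  shift-∈T : ∀ {k c a M} → a ∈T M → rshift k c a ∈T shift k c M
  shift-∈T {c = c} (tvar {x}) with x <ᵇ c
  ... | true  = tvar
  ... | false = tvar
  shift-∈T (tlam x)    = tlam (shift-∈T x)
  shift-∈T (tapp x xs) = tapp (shift-∈T x) (shifts-∈T xs)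

  shifts-∈T : ∀ {k c ds Q} → All (_∈T Q) ds → All (_∈T shift k c Q) (rshifts k c ds)
  shifts-∈T []       = []
  shifts-∈T (x ∷ xs) = shift-∈T x ∷ shifts-∈T xs

-- Invariant of the left-to-right rigid substitution of b⃗ for index d:
-- if it succeeds, the produced term expands P[Q/d] and the unused
-- suffix of b⃗ still consists of expansions of Q.
SubstInv : {A : Set} → (A → Set) → Term → Maybe (A × List RT) → Set
SubstInv Good Q nothing           = ⊤
SubstInv Good Q (just (r , rest)) = Good r × All (_∈T Q) rest

mutual
  rsub-∈T : ∀ {d a P Q bs} → a ∈T P → All (_∈T Q) bs →
            SubstInv (_∈T substAt d P Q) Q (rsub d a bs)
  rsub-∈T {d} (tvar {v}) bq with v <ᵇ d | v ≡ᵇ d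
  rsub-∈T tvar bq       | true  | _     = tvar , bq
  rsub-∈T tvar bq       | false | false = tvar , bq
  rsub-∈T tvar []       | false | true  = tt
  rsub-∈T tvar (b ∷ bq) | false | true  = shift-∈T b , bq
  rsub-∈T {d} {bs = bs} (tlam {a} x) bq with rsub (suc d) a bs | rsub-∈T {suc d} x bq
  ... | nothing       | _       = tt
  ... | just (_ , _)  | r , rest = tlam r , rest
  rsub-∈T {d} {bs = bs} (tapp {c} {ds = es} x xs) bq with rsub d c bs | rsub-∈T {d} x bq
  ... | nothing        | _        = tt
  ... | just (_ , bs₁) | r , rest with rsubs d es bs₁ | rsubs-∈T {d} xs rest
  ...   | nothing       | _          = tt
  ...   | just (_ , _)  | rs , rest′ = tapp r rs , rest′

  rsubs-∈T : ∀ {d es P Q bs} → All (_∈T P) es → All (_∈T Q) bs →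
             SubstInv (All (_∈T substAt d P Q)) Q (rsubs d es bs)
  rsubs-∈T [] bq = [] , bq
  rsubs-∈T {d} {bs = bs} (_∷_ {e} {es} x xs) bq with rsub d e bs | rsub-∈T {d} x bq
  ... | nothing        | _        = tt
  ... | just (_ , bs₁) | r , rest with rsubs d es bs₁ | rsubs-∈T {d} xs rest
  ...   | nothing       | _          = tt
  ...   | just (_ , _)  | rs , rest′ = r ∷ rs , rest′

rsubst-∈T : ∀ {c P Q ds} → c ∈T P → All (_∈T Q) ds → rsubst c ds ∈T₀ (P [ Q /0])
rsubst-∈T {c} {ds = ds} x xs with rsub 0 c ds | rsub-∈T {0} x xs
... | nothing           | _     = tt
... | just (_ , [])     | r , _ = r
... | just (_ , _ ∷ _)  | _     = tt

headIsVar-∈T : ∀ {a M} → a ∈T M → rheadIsVar a ≡ headIsVar M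
headIsVar-∈T tvar       = refl
headIsVar-∈T (tlam _)   = refl
headIsVar-∈T (tapp x _) = headIsVar-∈T x

mutual
  βnormal⇒rnormal : ∀ {a M} → a ∈T M → T (isNF M) → T (isRNF a)
  βnormal⇒rnormal tvar                  _  = tt
  βnormal⇒rnormal (tlam x)              nf = βnormal⇒rnormal x nf
  βnormal⇒rnormal (tapp tvar xs)        nf = βnormal⇒rnormals xs nf
  βnormal⇒rnormal (tapp (tlam _) _)     ()
  βnormal⇒rnormal (tapp (tapp x ys) xs) nf =
    ∧-intro (βnormal⇒rnormal (tapp x ys) (∧-elimˡ nf)) (βnormal⇒rnormals xs (∧-elimʳ nf))

  βnormal⇒rnormals : ∀ {ds Q} → All (_∈T Q) ds → T (isNF Q) → T (allRNF ds)
  βnormal⇒rnormals []       _  = tt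
  βnormal⇒rnormals (x ∷ xs) nf = ∧-intro (βnormal⇒rnormal x nf) (βnormal⇒rnormals xs nf)

-- Conversely, a positive →r-normal expansion certifies β-normality: every
-- application in a positive term has a first argument, which is a positive
-- expansion of the argument of the corresponding application of M.
positive-rnormal⇒βnormal : ∀ {a M} → a ∈T M → Positive a → T (isRNF a) → T (isNF M)
positive-rnormal⇒βnormal tvar _ _ = tt
positive-rnormal⇒βnormal (tlam x) (plam p) rn = positive-rnormal⇒βnormal x p rn
positive-rnormal⇒βnormal (tapp tvar (x ∷ _)) (papp _ (p ∷ _)) rn =
  positive-rnormal⇒βnormal x p (∧-elimˡ rn)
positive-rnormal⇒βnormal (tapp (tlam _) _) _ ()
positive-rnormal⇒βnormal (tapp {rapp c es} (tapp y ys) (_∷_ {d} {ds} x _)) (papp pc (p ∷ _)) rn =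
  ∧-intro (positive-rnormal⇒βnormal (tapp y ys) pc (∧-elimˡ rn))
          (positive-rnormal⇒βnormal x p (∧-elimˡ {isRNF d} {allRNF ds} (∧-elimʳ {isRNF (rapp c es)} rn)))

positive-rnormal⇒βnormal₀ : ∀ {r M} → r ∈T₀ M → PositiveR r → RNormal r → BetaNormal M
positive-rnormal⇒βnormal₀ {nothing} _ ()
positive-rnormal⇒βnormal₀ {just a}  x p rn = positive-rnormal⇒βnormal x p rn

-- L (and its non-normal branch L′, spine part Lsp) keeps every →r-normal
-- expansion: the redexes L contracts are invisible in a redex-free expansion.
mutual
  rnormal-∈T-L : ∀ {a M} → a ∈T M → T (isRNF a) → a ∈T L M
  rnormal-∈T-L {a} {M} x rn = if-elim (a ∈T_) (isNF M) x (rnormal-∈T-L′ x rn)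

  rnormal-∈T-L′ : ∀ {a M} → a ∈T M → T (isRNF a) → a ∈T L′ M
  rnormal-∈T-L′ tvar        _  = tvar
  rnormal-∈T-L′ (tlam x)    rn = tlam (rnormal-∈T-L′ x rn)
  rnormal-∈T-L′ (tapp x xs) rn = rnormal-∈T-Lsp (tapp x xs) rn

  rnormal-∈T-Lsp : ∀ {a M} → a ∈T M → T (isRNF a) → a ∈T Lsp M
  rnormal-∈T-Lsp tvar                _  = tvar
  rnormal-∈T-Lsp (tlam x)            _  = tlam x
  rnormal-∈T-Lsp (tapp tvar xs)      rn = tapp tvar (rnormal-∈T-Ls xs rn)
  rnormal-∈T-Lsp (tapp (tlam _) _)   ()
  rnormal-∈T-Lsp {a} (tapp {P = app P₁ _} (tapp y ys) xs) rn =
    if-elim (a ∈T_) (headIsVar P₁)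
      (tapp (rnormal-∈T-Lsp (tapp y ys) (∧-elimˡ rn)) (rnormal-∈T-Ls xs (∧-elimʳ rn)))
      (tapp (rnormal-∈T-Lsp (tapp y ys) (∧-elimˡ rn)) xs)

  rnormal-∈T-Ls : ∀ {ds Q} → All (_∈T Q) ds → T (allRNF ds) → All (_∈T L Q) ds
  rnormal-∈T-Ls []       _  = []
  rnormal-∈T-Ls (x ∷ xs) rn = rnormal-∈T-L x (∧-elimˡ rn) ∷ rnormal-∈T-Ls xs (∧-elimʳ rn)

mutual
  Lr-∈T : ∀ {a M} → a ∈T M → Lr (just a) ∈T₀ L M
  Lr-∈T {a} {M} x with isRNF a in rnf | isNF M in nf
  ... | true  | true  = x
  ... | true  | false = rnormal-∈T-L′ x (Equivalence.from T-≡ rnf)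
  ... | false | true  = ⊥-elim (subst T rnf (βnormal⇒rnormal x (Equivalence.from T-≡ nf)))
  ... | false | false = Lr′-∈T x

  Lr′-∈T : ∀ {a M} → a ∈T M → Lr′ a ∈T₀ L′ M
  Lr′-∈T tvar = tvar
  Lr′-∈T (tlam {a} x) with Lr′ a | Lr′-∈T x
  ... | nothing | _  = tt
  ... | just _  | x′ = tlam x′
  Lr′-∈T (tapp x xs) = Lrsp-∈T (tapp x xs)

  Lrsp-∈T : ∀ {a M} → a ∈T M → Lrsp a ∈T₀ Lsp M
  Lrsp-∈T tvar               = tvar
  Lrsp-∈T (tlam x)           = tlam x
  Lrsp-∈T (tapp (tlam x) xs) = rsubst-∈T x xs
  Lrsp-∈T (tapp {ds = ds} tvar xs) with Lrs ds | Lrs-∈T xs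
  ... | nothing | _   = tt
  ... | just _  | xs′ = tapp tvar xs′
  Lrsp-∈T (tapp {rapp c es} {app P₁ _} {ds} (tapp y ys) xs)
    with Lrsp (rapp c es) | Lrsp-∈T (tapp y ys)
  ... | nothing | _  = tt
  ... | just _  | y′ with rheadIsVar c | headIsVar P₁ | headIsVar-∈T y
  ...   | false | false | refl = tapp y′ xs
  ...   | true  | true  | refl with Lrs ds | Lrs-∈T xs
  ...     | nothing | _   = tt
  ...     | just _  | xs′ = tapp y′ xs′

  Lrs-∈T : ∀ {ds Q} → All (_∈T Q) ds → Lrs ds ∈Tˢ L Q
  Lrs-∈T [] = []
  Lrs-∈T (_∷_ {d} {ds} x xs) with Lr (just d) | Lr-∈T x | Lrs ds | Lrs-∈T xs
  ... | just _  | x′ | just _  | xs′ = x′ ∷ xs′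
  ... | just _  | _  | nothing | _   = tt
  ... | nothing | _  | _       | _   = tt

iter-Lr-∈T : ∀ n {r M} → r ∈T₀ M → iter n Lr r ∈T₀ iter n L M
iter-Lr-∈T zero    x = x
iter-Lr-∈T (suc n) x = Lr₀-∈T (iter-Lr-∈T n x)
  where
  Lr₀-∈T : ∀ {r M} → r ∈T₀ M → Lr r ∈T₀ L M
  Lr₀-∈T {nothing} _ = tt
  Lr₀-∈T {just _}  x = Lr-∈T x

mainTheorem5 : (M : Term) (n : ℕ) →
    (∃ λ a → a ∈T M × PositiveR (iter n Lr (just a)) × RNormal (iter n Lr (just a))) →
    BetaNormal (iter n L M)
mainTheorem5 M n (a , a∈TM , positive , normal) =
  positive-rnormal⇒βnormal₀ (iter-Lr-∈T n {just a} a∈TM) positive normal
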